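{- Let $G$ and $H$ be finite, simple, undirected, connected graphs, where $G$ has the uni-ecc property and center $C_G$, let $A\ge1$ and $B\ge0$ be integers, and let $\varphi:V(G)\to V(H)$ be a surjective mapping satisfying $\frac1A d_G(x,y)-B\le d_H(\varphi(x),\varphi(y))\le d_G(x,y)$ for all $x,y\in V(G)$. Then the center-shift $d_G(C_G,\varphi^{ -1}(C_H))$ is at most $(A-1)\,\mathrm{rad}(H)+AB$, where $C_H$ is the center of $H$.
   Context: Distances are shortest-path distances; $d(S_1,S_2)=\min\{d(a,b):a\in S_1,b\in S_2\}$. $\mathrm{ecc}(v)=\max_x d(v,x)$; the center is the set of vertices of minimum eccentricity and $\mathrm{rad}$ the minimum eccentricity. $G$ has the uni-ecc property if $d_G(C_G,v)=\mathrm{ecc}(v)-\mathrm{rad}(G)$ for all $v$. The center-shift of a surjective map $\varphi:G\to H$ is $d_G(C_G,\varphi^{ -1}(C_H))$. -}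

module Defs where

open import Level using (0ℓ)
open import Data.Nat using (ℕ; zero; suc; _+_; _*_; _∸_; _≤_; NonZero)
open import Data.Fin using (Fin)
open import Data.Product using (Σ; ∃; _×_; _,_)
open import Relation.Nullary using (¬_; Dec)
open import Relation.Binary.PropositionalEquality using (_≡_)

record Graph : Set₁ where
  field
    n      : ℕ
    Adj    : Fin n → Fin n → Set
    adj?   : ∀ x y → Dec (Adj x y)
    symm   : ∀ {x y} → Adj x y → Adj y x
    irrefl : ∀ {x} → ¬ Adj x x

open Graph public

data Walk (G : Graph) : Fin (n G) → Fin (n G) → ℕ → Set where
  here : ∀ {x} → Walk G x x zero
  step : ∀ {x y z k} → Adj G x y → Walk G y z k → Walk G x z (suc k)

-- Connected (and nonempty, as usual for connected graphs).
Connected : Graph → Set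
Connected G = NonZero (n G) × (∀ x y → ∃ λ k → Walk G x y k)

Dist : (G : Graph) → Fin (n G) → Fin (n G) → ℕ → Set
Dist G x y k = Walk G x y k × (∀ m → Walk G x y m → k ≤ m)

Ecc : (G : Graph) → Fin (n G) → ℕ → Set
Ecc G v e = (∀ x → ∃ λ k → Dist G v x k × k ≤ e) × (∃ λ x → Dist G v x e)

Rad : Graph → ℕ → Set
Rad G r = (∃ λ v → Ecc G v r) × (∀ v e → Ecc G v e → r ≤ e)

Center : (G : Graph) → Fin (n G) → Set
Center G v = ∃ λ r → Rad G r × Ecc G v r

SetDist : (G : Graph) → (Fin (n G) → Set) → (Fin (n G) → Set) → ℕ → Set
SetDist G S T k =
  (∃ λ a → ∃ λ b → S a × T b × Dist G a b k) ×
  (∀ a b m → S a → T b → Dist G a b m → k ≤ m)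

UniEcc : Graph → Set
UniEcc G = ∀ v k e r → SetDist G (Center G) (λ x → x ≡ v) k → Ecc G v e → Rad G r → k ≡ e ∸ r

Preimage : (G H : Graph) → (Fin (n G) → Fin (n H)) → (Fin (n H) → Set) → Fin (n G) → Set
Preimage G H φ S x = S (φ x)

Surjective : (G H : Graph) → (Fin (n G) → Fin (n H)) → Set
Surjective G H φ = ∀ y → ∃ λ x → φ x ≡ y

-- Take a central vertex c of H and a preimage x of c.  The coarse lower bound turns a
-- farthest vertex from x into ecc(x) ≤ A·rad(H) + AB, and since φ is a surjective
-- contraction every eccentricity in H is at most the eccentricity of a preimage, so
-- rad(H) ≤ rad(G).  By the uni-ecc property d(C_G, x) = ecc(x) − rad(G), which is
-- therefore at most (A − 1)·rad(H) + AB; and x lies in φ⁻¹(C_H).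
module Submission where

open import Defs
open import Data.Nat using (ℕ; suc; NonZero; _+_; _*_; _∸_; _≤_; _<_; _≟_)
open import Data.Nat.Properties
open import Data.Nat.Induction using (<-wellFounded)
open import Data.Fin using (Fin; zero)
open import Data.Fin.Properties using (any?) renaming (_≟_ to _≟ᶠ_)
open import Data.List using (allFin)
open import Data.List.Extrema.Nat using (argmax; argmin; f[xs]≤f[argmax]; f[argmin]≤f[xs])
open import Data.List.Relation.Unary.All using (lookup)
open import Data.List.Membership.Propositional.Properties using (∈-allFin)
open import Data.Product using (∃; _×_; _,_; proj₁; proj₂)
open import Induction.WellFounded using (Acc; acc)
open import Relation.Nullary using (Dec; yes; no)
open import Relation.Nullary.Decidable using (_×-dec_)
open import Relation.Unary using (Decidable)
open import Relation.Binary.PropositionalEquality using (_≡_; refl; cong; subst)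

IsLeast : (ℕ → Set) → ℕ → Set
IsLeast P k = P k × (∀ m → P m → k ≤ m)

IsLeast-unique : ∀ {P k k′} → IsLeast P k → IsLeast P k′ → k ≡ k′
IsLeast-unique (p , min) (p′ , min′) = ≤-antisym (min _ p′) (min′ _ p)

module _ {P : ℕ → Set} (P? : Decidable P) where

  ∃-least-acc : ∀ {w} → Acc _<_ w → P w → ∃ (IsLeast P)
  ∃-least-acc {w} (acc below) Pw with anyUpTo? P? w
  ... | yes (m , m<w , Pm) = ∃-least-acc (below m<w) Pm
  ... | no none            = w , Pw , λ m Pm → ≮⇒≥ (λ m<w → none (m , m<w , Pm))

  ∃-least : ∀ {w} → P w → ∃ (IsLeast P)
  ∃-least = ∃-least-acc (<-wellFounded _)

unique⇒decidable : ∀ {P : ℕ → Set} → ∃ P → (∀ {k k′} → P k → P k′ → k ≡ k′) → Decidable P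
unique⇒decidable (k , Pk) unique m with k ≟ m
... | yes refl = yes Pk
... | no k≢m   = no λ Pm → k≢m (unique Pk Pm)

module _ (G : Graph) where

  Dist-unique : ∀ {x y k k′} → Dist G x y k → Dist G x y k′ → k ≡ k′
  Dist-unique = IsLeast-unique

  Ecc-unique : ∀ {v e e′} → Ecc G v e → Ecc G v e′ → e ≡ e′
  Ecc-unique E E′ = ≤-antisym (Ecc-≤ E E′) (Ecc-≤ E′ E)
    where
    Ecc-≤ : ∀ {v e e′} → Ecc G v e → Ecc G v e′ → e ≤ e′
    Ecc-≤ (_ , x , Dvx) (bounded , _) with bounded x
    ... | k , Dk , k≤e′ = subst (_≤ _) (Dist-unique Dk Dvx) k≤e′

  Rad-unique : ∀ {r r′} → Rad G r → Rad G r′ → r ≡ r′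
  Rad-unique ((v , E) , min) ((v′ , E′) , min′) = ≤-antisym (min v′ _ E′) (min′ v _ E)

  SetDist-antitoneʳ : ∀ {S T T′ k k′} → (∀ x → T x → T′ x) →
                      SetDist G S T k → SetDist G S T′ k′ → k′ ≤ k
  SetDist-antitoneʳ T⊆T′ ((a , b , Sa , Tb , Dab) , _) (_ , min′) = min′ a b _ Sa (T⊆T′ b Tb) Dab

module ConnectedGraph (G : Graph) (conn : Connected G) where

  V : Set
  V = Fin (n G)

  walk? : ∀ m x y → Dec (Walk G x y m)
  walk? 0 x y with x ≟ᶠ y
  ... | yes refl = yes here
  ... | no x≢y   = no λ { here → x≢y refl }
  walk? (suc m) x y with any? (λ z → adj? G x z ×-dec walk? m z y)
  ... | yes (z , xz , w) = yes (step xz w)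
  ... | no none          = no λ { (step xz w) → none (_ , xz , w) }

  dist : ∀ x y → ∃ (Dist G x y)
  dist x y = ∃-least (λ m → walk? m x y) (proj₂ (proj₂ conn x y))

  dist? : ∀ x y → Decidable (Dist G x y)
  dist? x y = unique⇒decidable (dist x y) (Dist-unique G)

  d : V → V → ℕ
  d x y = proj₁ (dist x y)

  farthest : V → V
  farthest v = argmax (d v) v (allFin _)

  eccentricity : V → ℕ
  eccentricity v = d v (farthest v)

  ecc : ∀ v → Ecc G v (eccentricity v)
  ecc v = (λ x → d v x , proj₂ (dist v x) , lookup (f[xs]≤f[argmax] {f = d v} v (allFin _)) (∈-allFin x))
        , farthest v , proj₂ (dist v (farthest v))

  ecc? : ∀ v → Decidable (Ecc G v)
  ecc? v = unique⇒decidable (_ , ecc v) (Ecc-unique G)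

  central : V
  central = argmin eccentricity (vertex (proj₁ conn)) (allFin _)
    where
    vertex : ∀ {m} → NonZero m → Fin m
    vertex {suc _} _ = zero

  radius : ℕ
  radius = eccentricity central

  rad : Rad G radius
  rad = (central , ecc central)
      , λ v e E → subst (_ ≤_) (Ecc-unique G (ecc v) E)
                    (lookup (f[argmin]≤f[xs] {f = eccentricity} _ (allFin _)) (∈-allFin v))

  center? : Decidable (Center G)
  center? v with ecc? v _
  ... | yes E = yes (_ , rad , E)
  ... | no ¬E = no λ { (_ , R , E) → ¬E (subst (Ecc G v) (Rad-unique G R rad) E) }

  setDist : ∀ {S T a b} → Decidable S → Decidable T → S a → T b → ∃ (SetDist G S T)
  setDist {S} {T} {a} {b} S? T? Sa Tb
    with ∃-least (λ m → any? λ a → any? λ b → S? a ×-dec T? b ×-dec dist? a b m)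
                 (a , b , Sa , Tb , proj₂ (dist a b))
  ... | k , joined , min = k , joined , λ a b m Sa Tb Dab → min m (a , b , Sa , Tb , Dab)

module _ (G H : Graph) (φ : Fin (n G) → Fin (n H)) where

  Contraction : Set
  Contraction = ∀ x y dG dH → Dist G x y dG → Dist H (φ x) (φ y) dH → dH ≤ dG

  CoarselyExpanding : ℕ → ℕ → Set
  CoarselyExpanding A C = ∀ x y dG dH → Dist G x y dG → Dist H (φ x) (φ y) dH → dG ≤ A * dH + C

  Ecc-contraction : Surjective G H φ → Contraction →
                    ∀ {x e e′} → Ecc G x e → Ecc H (φ x) e′ → e′ ≤ e
  Ecc-contraction surj contr {x} (bounded , _) (_ , h , Dh) with surj h
  ... | y , refl with bounded y
  ... | k , Dk , k≤e = ≤-trans (contr x y k _ Dk Dh) k≤e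

  Rad-contraction : Connected H → Surjective G H φ → Contraction →
                    ∀ {rG rH} → Rad G rG → Rad H rH → rH ≤ rG
  Rad-contraction connH surj contr ((g , Eg) , _) (_ , minH) =
    ≤-trans (minH (φ g) _ (ecc (φ g))) (Ecc-contraction surj contr Eg (ecc (φ g)))
    where open ConnectedGraph H connH

  Ecc-coarselyExpanding : ∀ A C → CoarselyExpanding A C →
                          ∀ {x e e′} → Ecc G x e → Ecc H (φ x) e′ → e ≤ A * e′ + C
  Ecc-coarselyExpanding A C expand {x} (_ , y , Dxy) (bounded , _) with bounded (φ y)
  ... | k , Dk , k≤e′ = ≤-trans (expand x y _ k Dxy Dk) (+-monoˡ-≤ C (*-monoʳ-≤ A k≤e′))

e∸r′≤[A∸1]*r+C : ∀ A C {r r′ e} → 1 ≤ A → r ≤ r′ → e ≤ A * r + C → e ∸ r′ ≤ (A ∸ 1) * r + C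
e∸r′≤[A∸1]*r+C (suc A) C {r} {r′} {e} _ r≤r′ e≤ = begin
  e ∸ r′               ≤⟨ ∸-monoʳ-≤ e r≤r′ ⟩
  e ∸ r                ≤⟨ ∸-monoˡ-≤ r e≤ ⟩
  r + A * r + C ∸ r    ≡⟨ cong (_∸ r) (+-assoc r (A * r) C) ⟩
  r + (A * r + C) ∸ r  ≡⟨ m+n∸m≡n r (A * r + C) ⟩
  A * r + C            ∎
  where open ≤-Reasoning

corollary4 : (G H : Graph) → Connected G → Connected H → UniEcc G →
    (A B : ℕ) → 1 ≤ A →
    (φ : Fin (n G) → Fin (n H)) → Surjective G H φ →
    (∀ x y dG dH → Dist G x y dG → Dist H (φ x) (φ y) dH → dG ≤ A * dH + A * B × dH ≤ dG) →
    ∀ rH → Rad H rH →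
    ∃ λ k → SetDist G (Center G) (Preimage G H φ (Center H)) k × k ≤ (A ∸ 1) * rH + A * B
corollary4 G H connG connH uniEcc A B 1≤A φ surj quasiIsometric rH radH@((c , Ec) , _)
  with surj c
... | x , refl = proj₁ SD , proj₂ SD , (begin
  proj₁ SD                   ≤⟨ SetDist-antitoneʳ G (λ { _ refl → centralH }) (proj₂ SD₀) (proj₂ SD) ⟩
  proj₁ SD₀                  ≡⟨ uniEcc x _ _ _ (proj₂ SD₀) (ecc x) rad ⟩
  eccentricity x ∸ radius    ≤⟨ e∸r′≤[A∸1]*r+C A (A * B) 1≤A rH≤radius eccx≤ ⟩
  (A ∸ 1) * rH + A * B       ∎)
  where
  open ConnectedGraph G connG
  open ≤-Reasoning

  contraction : Contraction G H φ
  contraction x y dG dH Dx Dy = proj₂ (quasiIsometric x y dG dH Dx Dy)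

  expansion : CoarselyExpanding G H φ A (A * B)
  expansion x y dG dH Dx Dy = proj₁ (quasiIsometric x y dG dH Dx Dy)

  rH≤radius : rH ≤ radius
  rH≤radius = Rad-contraction G H φ connH surj contraction rad radH

  eccx≤ : eccentricity x ≤ A * rH + A * B
  eccx≤ = Ecc-coarselyExpanding G H φ A (A * B) expansion (ecc x) Ec

  centralG : Center G central
  centralG = _ , rad , ecc central

  centralH : Center H (φ x)
  centralH = rH , radH , Ec

  SD₀ : ∃ (SetDist G (Center G) (_≡ x))
  SD₀ = setDist center? (_≟ᶠ x) centralG refl

  SD : ∃ (SetDist G (Center G) (Preimage G H φ (Center H)))
  SD = setDist center? (λ z → ConnectedGraph.center? H connH (φ z)) centralG centralH
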